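{- For every real $R\ge 1$ and every real $\epsilon$ with $0<\epsilon<1$, the competitive ratio of the proportional\&removable online knapsack problem with a buffer of capacity $R$ is at least $1+\frac{1}{\lceil 2R\rceil+1}-\epsilon$.
   Context: Online knapsack problem with a resource buffer: there is a knapsack of capacity $1$ and a buffer of capacity $R\ge 1$. Items $e_1,\dots,e_n$ arrive one by one; each item $e$ has size $0<s(e)\le 1$ and value $v(e)\ge 0$; $s(B),v(B)$ denote sums over a set $B$. A deterministic online algorithm maintains buffer contents $B_0=\emptyset,B_1,\dots,B_n$, with $B_i$ chosen after seeing only $e_1,\dots,e_i$, $B_i\subseteq B_{i-1}\cup\{e_i\}$ and $s(B_i)\le R$ (removable setting). $\mathrm{ALG}(I)=\max\{v(B)\mid B\subseteq B_n,\ s(B)\le 1\}$, $\mathrm{OPT}(I)=\max\{v(B)\mid B\subseteq\{e_1,\dots,e_n\},\ s(B)\le 1\}$. "Proportional" means $v(e)=s(e)$ for every item. The competitive ratio of an algorithm is $\sup_I \mathrm{OPT}(I)/\mathrm{ALG}(I)$ (with $a/0=\infty$ for $a>0$), and the competitive ratio of the problem is the infimum of this over all deterministic online algorithms.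
   Formalization: The buffer capacity R and ε are rational rather than real, and the item sizes are taken in the rationals, so the online algorithms act only on rational item sequences. -}

module Defs where

open import Data.Bool using (Bool; true; false)
open import Data.Nat as ℕ using (ℕ; zero; suc)
open import Data.Integer as ℤ using (ℤ)
open import Data.Rational using (ℚ; 0ℚ; 1ℚ; _+_; _-_; _*_; _≤_; _<_; _/_; ceiling)
open import Data.Product using (_×_; Σ; ∃; ∃-syntax; _,_)
open import Data.Vec using (Vec; []; _∷_; _∷ʳ_)
open import Data.Vec.Relation.Unary.All using (All)
open import Data.Fin.Subset using (Subset; _⊆_; ⊤)

sizeOf : ∀ {n} → Vec ℚ n → Subset n → ℚ
sizeOf [] [] = 0ℚ
sizeOf (x ∷ xs) (true ∷ b) = x + sizeOf xs b
sizeOf (x ∷ xs) (false ∷ b) = sizeOf xs b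

ValidItem : ℚ → Set
ValidItem s = (0ℚ < s) × (s ≤ 1ℚ)

-- an instance of length n is a vector of item sizes (values equal sizes)
ValidInstance : ∀ {n} → Vec ℚ n → Set
ValidInstance xs = All ValidItem xs

IsBestPacking : ∀ {n} → Vec ℚ n → Subset n → ℚ → Set
IsBestPacking xs S v =
  (∃[ B ] (B ⊆ S) × (sizeOf xs B ≤ 1ℚ) × (sizeOf xs B ≡ v))
  × (∀ B → B ⊆ S → sizeOf xs B ≤ 1ℚ → sizeOf xs B ≤ v)
  where open import Relation.Binary.PropositionalEquality using (_≡_)

-- A deterministic online algorithm (removable setting) with buffer R:
-- after seeing the prefix e_1..e_i it holds buffer B_i ⊆ {1..i}, which
-- depends only on that prefix.  B_0 = ∅ is automatic (Subset 0).
record OnlineAlg (R : ℚ) : Set where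
  field
    buffer : ∀ {n} → Vec ℚ n → Subset n
    removable : ∀ {n} (xs : Vec ℚ n) (x : ℚ) →
      ValidInstance (xs ∷ʳ x) → buffer (xs ∷ʳ x) ⊆ (buffer xs ∷ʳ true)
    capacity : ∀ {n} (xs : Vec ℚ n) → ValidInstance xs → sizeOf xs (buffer xs) ≤ R
open OnlineAlg public

-- "sup_I OPT(I)/ALG(I) ≥ c" (with a/0 = ∞ for a > 0):
-- for every δ > 0 there is an instance with OPT > (c - δ)·ALG.
CompRatioAtLeast : ∀ {R} → OnlineAlg R → ℚ → Set
CompRatioAtLeast A c =
  ∀ δ → 0ℚ < δ →
    ∃[ n ] Σ (Vec ℚ n) λ xs → ValidInstance xs ×
      (∃[ opt ] ∃[ alg ] IsBestPacking xs ⊤ opt ×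
         IsBestPacking xs (buffer A xs) alg × ((c - δ) * alg < opt))

-- 1 + 1/(⌈2R⌉+1); for R ≥ 1, ⌈2R⌉ ≥ 2 so ⌈2R⌉ = ∣⌈2R⌉∣
bound : ℚ → ℚ
bound R = 1ℚ + (ℤ.+ 1 / suc ℤ.∣ ceiling ((ℤ.+ 2 / 1) * R) ∣)

{-# OPTIONS --safe #-}
module Submission where

-- Let k = ⌈2R⌉ and M = 1 + k(k+2); all sizes are fractions with denominator (k+1)M.
-- The adversary first presents items of sizes (iM+1)/((k+1)M) for i = k, …, 1.  They
-- total more than k/2 ≥ R, so the buffer misses some item i.  The adversary then adds
-- one item of size ((k+1-i)M - 1)/((k+1)M), which together with item i fills the
-- knapsack exactly, so OPT = 1.  A set of first-round items other than item i, with
-- index sum m and r ≤ k elements, has numerator mM + r.  If it fits into the knapsack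
-- then m ≤ k; if it fits together with the last item then m < i, since m = i would need
-- r ≥ 2 and overflow.  Hence ALG ≤ (kM+k)/((k+1)M), and
-- (1 + 1/(k+1)) · (kM+k)/((k+1)M) < 1 because k(k+2) < M.

open import Data.Nat using (ℕ)

module Fractions where

  open import Data.Nat as ℕ using (suc)
  import Data.Nat.Properties as ℕ
  open import Data.Integer as ℤ using (+_; ∣_∣)
  import Data.Integer.Properties as ℤ
  open import Data.Integer.DivMod using ([n/d]*d≤n)
  open import Data.Rational
    using (ℚ; mkℚ; 0ℚ; 1ℚ; _+_; _*_; _-_; -_; _≤_; _<_; _/_; ↥_; ↧_; toℚᵘ; floor; ceiling)
  open import Data.Rational.Properties
    using ( ≤-antisym; +-monoʳ-≤; +-identityʳ; neg-antimono-≤; ↥-neg; ↧-neg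
          ; toℚᵘ-fromℚᵘ; toℚᵘ-injective; toℚᵘ-mono-≤; toℚᵘ-cancel-≤; toℚᵘ-cancel-<
          ; toℚᵘ-homo-+; toℚᵘ-homo-* )
  open import Data.Rational.Unnormalised as ℚᵘ using (mkℚᵘ; *≤*; *<*) renaming (_≃_ to _≃ᵘ_)
  import Data.Rational.Unnormalised.Properties as ℚᵘ
  open import Relation.Binary.PropositionalEquality

  frac : ℕ → ℕ → ℚ
  frac a d = + a / suc d

  toℚᵘ-frac : ∀ a d → toℚᵘ (frac a d) ≃ᵘ mkℚᵘ (+ a) d
  toℚᵘ-frac a d = toℚᵘ-fromℚᵘ (mkℚᵘ (+ a) d)

  frac≤frac : ∀ a d b e → a ℕ.* suc e ℕ.≤ b ℕ.* suc d → frac a d ≤ frac b e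
  frac≤frac a d b e h = toℚᵘ-cancel-≤
    (ℚᵘ.≤-respʳ-≃ (ℚᵘ.≃-sym (toℚᵘ-frac b e)) (ℚᵘ.≤-respˡ-≃ (ℚᵘ.≃-sym (toℚᵘ-frac a d))
      (*≤* (subst₂ ℤ._≤_ (ℤ.pos-* a (suc e)) (ℤ.pos-* b (suc d)) (ℤ.+≤+ h)))))

  frac<frac : ∀ a d b e → a ℕ.* suc e ℕ.< b ℕ.* suc d → frac a d < frac b e
  frac<frac a d b e h = toℚᵘ-cancel-<
    (ℚᵘ.<-respʳ-≃ (ℚᵘ.≃-sym (toℚᵘ-frac b e)) (ℚᵘ.<-respˡ-≃ (ℚᵘ.≃-sym (toℚᵘ-frac a d))
      (*<* (subst₂ ℤ._<_ (ℤ.pos-* a (suc e)) (ℤ.pos-* b (suc d)) (ℤ.+<+ h)))))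

  frac≤frac⇒*≤* : ∀ a d b e → frac a d ≤ frac b e → a ℕ.* suc e ℕ.≤ b ℕ.* suc d
  frac≤frac⇒*≤* a d b e h
    with ℚᵘ.≤-respʳ-≃ (toℚᵘ-frac b e) (ℚᵘ.≤-respˡ-≃ (toℚᵘ-frac a d) (toℚᵘ-mono-≤ h))
  ... | *≤* h′ = ℤ.drop‿+≤+ (subst₂ ℤ._≤_ (sym (ℤ.pos-* a (suc e))) (sym (ℤ.pos-* b (suc d))) h′)

  frac-cong : ∀ a d b e → a ℕ.* suc e ≡ b ℕ.* suc d → frac a d ≡ frac b e
  frac-cong a d b e eq =
    ≤-antisym (frac≤frac a d b e (ℕ.≤-reflexive eq)) (frac≤frac b e a d (ℕ.≤-reflexive (sym eq)))

  frac-+ : ∀ a d b e → frac a d + frac b e ≡ frac (a ℕ.* suc e ℕ.+ b ℕ.* suc d) (e ℕ.+ d ℕ.* suc e)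
  frac-+ a d b e = toℚᵘ-injective (begin-equality
    toℚᵘ (frac a d + frac b e)            ≃⟨ toℚᵘ-homo-+ (frac a d) (frac b e) ⟩
    toℚᵘ (frac a d) ℚᵘ.+ toℚᵘ (frac b e)  ≃⟨ ℚᵘ.+-cong (toℚᵘ-frac a d) (toℚᵘ-frac b e) ⟩
    mkℚᵘ (+ a) d ℚᵘ.+ mkℚᵘ (+ b) e        ≡⟨ cong (λ n → mkℚᵘ n de) numerator ⟩
    mkℚᵘ (+ c) de                         ≃⟨ toℚᵘ-frac c de ⟨
    toℚᵘ (frac c de)                      ∎)
    where
    open ℚᵘ.≤-Reasoning
    c = a ℕ.* suc e ℕ.+ b ℕ.* suc d
    de = e ℕ.+ d ℕ.* suc e
    numerator : + a ℤ.* + suc e ℤ.+ + b ℤ.* + suc d ≡ + c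
    numerator = trans (cong₂ ℤ._+_ (sym (ℤ.pos-* a (suc e))) (sym (ℤ.pos-* b (suc d))))
                      (sym (ℤ.pos-+ (a ℕ.* suc e) (b ℕ.* suc d)))

  frac-* : ∀ a d b e → frac a d * frac b e ≡ frac (a ℕ.* b) (e ℕ.+ d ℕ.* suc e)
  frac-* a d b e = toℚᵘ-injective (begin-equality
    toℚᵘ (frac a d * frac b e)            ≃⟨ toℚᵘ-homo-* (frac a d) (frac b e) ⟩
    toℚᵘ (frac a d) ℚᵘ.* toℚᵘ (frac b e)  ≃⟨ ℚᵘ.*-cong (toℚᵘ-frac a d) (toℚᵘ-frac b e) ⟩
    mkℚᵘ (+ a) d ℚᵘ.* mkℚᵘ (+ b) e        ≡⟨ cong (λ n → mkℚᵘ n de) (sym (ℤ.pos-* a b)) ⟩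
    mkℚᵘ (+ (a ℕ.* b)) de                 ≃⟨ toℚᵘ-frac (a ℕ.* b) de ⟨
    toℚᵘ (frac (a ℕ.* b) de)              ∎)
    where
    open ℚᵘ.≤-Reasoning
    de = e ℕ.+ d ℕ.* suc e

  frac-1 : ∀ d → frac (suc d) d ≡ 1ℚ
  frac-1 d = frac-cong (suc d) d 1 0 (trans (ℕ.*-identityʳ (suc d)) (sym (ℕ.*-identityˡ (suc d))))

  frac≤1⇒≤ : ∀ {a d} → frac a d ≤ 1ℚ → a ℕ.≤ suc d
  frac≤1⇒≤ {a} {d} h = subst₂ ℕ._≤_ (ℕ.*-identityʳ a) (ℕ.+-identityʳ (suc d)) (frac≤frac⇒*≤* a d 1 0 h)

  ≤⇒frac≤1 : ∀ {a d} → a ℕ.≤ suc d → frac a d ≤ 1ℚ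
  ≤⇒frac≤1 {a} {d} h =
    frac≤frac a d 1 0 (subst₂ ℕ._≤_ (sym (ℕ.*-identityʳ a)) (sym (ℕ.+-identityʳ (suc d))) h)

  i≤+∣i∣ : ∀ i → i ℤ.≤ + ∣ i ∣
  i≤+∣i∣ (+ n)      = ℤ.≤-refl
  i≤+∣i∣ ℤ.-[1+ n ] = ℤ.-≤+

  ⌊q⌋*↧q≤↥q : ∀ q → floor q ℤ.* ↧ q ℤ.≤ ↥ q
  ⌊q⌋*↧q≤↥q (mkℚ n d _) = [n/d]*d≤n n (+ suc d)

  p≤frac∣⌈p⌉∣ : ∀ p → p ≤ frac ∣ ceiling p ∣ 0
  p≤frac∣⌈p⌉∣ p@(mkℚ n d _) =
    toℚᵘ-cancel-≤ (ℚᵘ.≤-respʳ-≃ (ℚᵘ.≃-sym (toℚᵘ-frac ∣ c ∣ 0)) (*≤* n*1≤∣c∣*d))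
    where
    c = ceiling p
    ⌊-p⌋*d≤-n : floor (- p) ℤ.* + suc d ℤ.≤ ℤ.- n
    ⌊-p⌋*d≤-n = subst₂ (λ m i → floor (- p) ℤ.* m ℤ.≤ i) (↧-neg p) (↥-neg p) (⌊q⌋*↧q≤↥q (- p))
    n≤c*d : n ℤ.≤ c ℤ.* + suc d
    n≤c*d = subst₂ ℤ._≤_ (ℤ.neg-involutive n) (ℤ.neg-distribˡ-* (floor (- p)) (+ suc d))
                   (ℤ.neg-mono-≤ ⌊-p⌋*d≤-n)
    n*1≤∣c∣*d : n ℤ.* + 1 ℤ.≤ + ∣ c ∣ ℤ.* + suc d
    n*1≤∣c∣*d = subst (ℤ._≤ + ∣ c ∣ ℤ.* + suc d) (sym (ℤ.*-identityʳ n))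
      (ℤ.≤-trans n≤c*d (ℤ.*-monoʳ-≤-nonNeg (+ suc d) (i≤+∣i∣ c)))

  p-q≤p : ∀ p {q} → 0ℚ ≤ q → p - q ≤ p
  p-q≤p p {q} 0≤q = subst (p - q ≤_) (+-identityʳ p) (+-monoʳ-≤ p (neg-antimono-≤ 0≤q))

module NatVectors where

  open import Data.Nat
  open import Data.Nat.Properties
  open import Data.Nat.Tactic.RingSolver using (solve-∀)
  open import Data.Empty using (⊥-elim)
  open import Data.Product using (∃-syntax; _×_; _,_)
  open import Data.Vec using (Vec; []; _∷_; _∷ʳ_; map; lookup; here; there)
  open import Data.Vec.Relation.Unary.All as All using (All; []; _∷_)
  open import Data.Fin using (Fin; zero; suc; toℕ)
  open import Data.Fin.Properties using (toℕ-injective; toℕ<n)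
  open import Data.Fin.Subset using (Subset; inside; outside; _∈_; _∉_; _⊆_; ∣_∣; ⊤; ⁅_⁆; ∁)
  open import Data.Fin.Subset.Properties
    using (drop-∷-⊆; nonempty?; x∈∁p⇒x∉p; x∉∁p⇒x∈p; ⊆⊤; ⊆-antisym; ∣⁅x⁆∣≡1; x∈⁅y⁆⇒x≡y)
  open import Relation.Nullary using (yes; no)
  open import Relation.Binary.PropositionalEquality

  All-∷ʳ⁺ : ∀ {A : Set} {P : A → Set} {n} {xs : Vec A n} {x} → All P xs → P x → All P (xs ∷ʳ x)
  All-∷ʳ⁺ []         px = px ∷ []
  All-∷ʳ⁺ (py ∷ pys) px = py ∷ All-∷ʳ⁺ pys px

  ∷ʳ-⊆⁻ : ∀ {n} {p q : Subset n} {x y} → p ∷ʳ x ⊆ q ∷ʳ y → p ⊆ q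
  ∷ʳ-⊆⁻ {p = inside ∷ _} {q = _ ∷ _} h here with h here
  ... | here = here
  ∷ʳ-⊆⁻ {p = _ ∷ _} {q = _ ∷ _} h (there x∈p) = there (∷ʳ-⊆⁻ (drop-∷-⊆ h) x∈p)

  ≢⊤⇒∃∉ : ∀ {n} {p : Subset n} → p ≢ ⊤ → ∃[ x ] x ∉ p
  ≢⊤⇒∃∉ {p = p} p≢⊤ with nonempty? (∁ p)
  ... | yes (x , x∈∁p) = x , x∈∁p⇒x∉p x∈∁p
  ... | no ∁p-empty    = ⊥-elim (p≢⊤ (⊆-antisym ⊆⊤ λ _ → x∉∁p⇒x∈p λ x∈∁p → ∁p-empty (_ , x∈∁p)))

  total : ∀ {n} → Vec ℕ n → Subset n → ℕ
  total []       []            = 0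
  total (a ∷ as) (inside ∷ S)  = a + total as S
  total (a ∷ as) (outside ∷ S) = total as S

  total-∷ʳ-inside : ∀ {n} (as : Vec ℕ n) b S → total (as ∷ʳ b) (S ∷ʳ inside) ≡ total as S + b
  total-∷ʳ-inside []       b []            = +-comm b 0
  total-∷ʳ-inside (a ∷ as) b (inside ∷ S)  =
    trans (cong (a +_) (total-∷ʳ-inside as b S)) (sym (+-assoc a (total as S) b))
  total-∷ʳ-inside (a ∷ as) b (outside ∷ S) = total-∷ʳ-inside as b S

  total-∷ʳ-outside : ∀ {n} (as : Vec ℕ n) b S → total (as ∷ʳ b) (S ∷ʳ outside) ≡ total as S
  total-∷ʳ-outside []       b []            = refl
  total-∷ʳ-outside (a ∷ as) b (inside ∷ S)  = cong (a +_) (total-∷ʳ-outside as b S)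
  total-∷ʳ-outside (a ∷ as) b (outside ∷ S) = total-∷ʳ-outside as b S

  total-affine : ∀ M {n} (is : Vec ℕ n) S → total (map (λ i → i * M + 1) is) S ≡ total is S * M + ∣ S ∣
  total-affine M []       []            = refl
  total-affine M (i ∷ is) (inside ∷ S)  = begin
    i * M + 1 + total (map (λ i → i * M + 1) is) S ≡⟨ cong (i * M + 1 +_) (total-affine M is S) ⟩
    i * M + 1 + (total is S * M + ∣ S ∣)            ≡⟨ regroup i (total is S) M ∣ S ∣ ⟩
    (i + total is S) * M + suc ∣ S ∣                ∎
    where
    open ≡-Reasoning
    regroup : ∀ i t M r → i * M + 1 + (t * M + r) ≡ (i + t) * M + suc r
    regroup = solve-∀
  total-affine M (i ∷ is) (outside ∷ S) = total-affine M is S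

  ∣p∣≡0⇒total≡0 : ∀ {n} (as : Vec ℕ n) S → ∣ S ∣ ≡ 0 → total as S ≡ 0
  ∣p∣≡0⇒total≡0 []       []            _    = refl
  ∣p∣≡0⇒total≡0 (a ∷ as) (outside ∷ S) ∣S∣≡0 = ∣p∣≡0⇒total≡0 as S ∣S∣≡0

  ∣p∣≡1⇒total≡lookup : ∀ {n} (as : Vec ℕ n) S → ∣ S ∣ ≡ 1 → ∃[ i ] i ∈ S × total as S ≡ lookup as i
  ∣p∣≡1⇒total≡lookup (a ∷ as) (inside ∷ S) ∣S∣≡1 =
    zero , here , trans (cong (a +_) (∣p∣≡0⇒total≡0 as S (suc-injective ∣S∣≡1))) (+-identityʳ a)
  ∣p∣≡1⇒total≡lookup (a ∷ as) (outside ∷ S) ∣S∣≡1 with ∣p∣≡1⇒total≡lookup as S ∣S∣≡1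
  ... | i , i∈S , eq = suc i , there i∈S , eq

  total-⁅⁆ : ∀ {n} (as : Vec ℕ n) i → total as ⁅ i ⁆ ≡ lookup as i
  total-⁅⁆ as i with ∣p∣≡1⇒total≡lookup as ⁅ i ⁆ (∣⁅x⁆∣≡1 i)
  ... | i′ , i′∈⁅i⁆ , eq = trans eq (cong (lookup as) (x∈⁅y⁆⇒x≡y i i′∈⁅i⁆))

  total≢lookup : ∀ {n} (as : Vec ℕ n) → (∀ {i j} → lookup as i ≡ lookup as j → i ≡ j) →
    ∀ S j → 0 < lookup as j → ∣ S ∣ ≤ 1 → j ∉ S → total as S ≢ lookup as j
  total≢lookup as injective S j positive ∣S∣≤1 j∉S eq with ∣ S ∣ in ∣S∣≡ | ∣S∣≤1
  ... | 0       | _       = <⇒≢ positive (trans (sym (∣p∣≡0⇒total≡0 as S ∣S∣≡)) eq)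
  ... | 2+ _    | s≤s ()
  ... | 1       | _ with ∣p∣≡1⇒total≡lookup as S ∣S∣≡
  ...   | i , i∈S , eqᵢ = j∉S (subst (_∈ S) (injective (trans (sym eqᵢ) eq)) i∈S)

  countdown : ∀ k → Vec ℕ k
  countdown zero    = []
  countdown (suc k) = suc k ∷ countdown k

  countdown-≤ : ∀ k → All (_≤ k) (countdown k)
  countdown-≤ zero    = []
  countdown-≤ (suc k) = ≤-refl ∷ All.map m≤n⇒m≤1+n (countdown-≤ k)

  toℕ+lookup-countdown : ∀ {k} (j : Fin k) → toℕ j + lookup (countdown k) j ≡ k
  toℕ+lookup-countdown zero    = refl
  toℕ+lookup-countdown (suc j) = cong suc (toℕ+lookup-countdown j)

  lookup-countdown-injective : ∀ {k} {i j : Fin k} → lookup (countdown k) i ≡ lookup (countdown k) j → i ≡ j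
  lookup-countdown-injective {i = i} {j} eq = toℕ-injective (+-cancelʳ-≡ _ (toℕ i) (toℕ j)
    (trans (toℕ+lookup-countdown i) (trans (sym (toℕ+lookup-countdown j)) (cong (toℕ j +_) (sym eq)))))

  lookup-countdown-positive : ∀ {k} (j : Fin k) → 0 < lookup (countdown k) j
  lookup-countdown-positive {k} j = +-cancelˡ-< (toℕ j) 0 _ (begin-strict
    toℕ j + 0                          ≡⟨ +-identityʳ (toℕ j) ⟩
    toℕ j                              <⟨ toℕ<n j ⟩
    k                                  ≡⟨ toℕ+lookup-countdown j ⟨
    toℕ j + lookup (countdown k) j     ∎)
    where open ≤-Reasoning

  total-countdown-⊤ : ∀ k → total (countdown k) ⊤ * 2 ≡ k * suc k
  total-countdown-⊤ zero    = refl
  total-countdown-⊤ (suc k) = begin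
    (suc k + total (countdown k) ⊤) * 2    ≡⟨ *-distribʳ-+ 2 (suc k) (total (countdown k) ⊤) ⟩
    suc k * 2 + total (countdown k) ⊤ * 2  ≡⟨ cong (suc k * 2 +_) (total-countdown-⊤ k) ⟩
    suc k * 2 + k * suc k                  ≡⟨ step k ⟩
    suc k * suc (suc k)                    ∎
    where
    open ≡-Reasoning
    step : ∀ k → suc k * 2 + k * suc k ≡ suc k * suc (suc k)
    step = solve-∀

module Knapsack where

  open import Data.Nat
  open import Data.Nat.Properties
  open import Data.Empty using (⊥; ⊥-elim)
  open import Data.Product using (∃-syntax; _×_; _,_)
  open import Data.Sum using (_⊎_; inj₁; inj₂)
  open import Data.Vec using (Vec; []; _∷_; here)
  open import Data.Fin.Subset using (Subset; inside; outside; _⊆_)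
  open import Data.Fin.Subset.Properties using (drop-∷-⊆; out⊆; in⊆in)
  open import Function using (case_of_)
  open import Relation.Nullary using (yes; no)
  open import Relation.Binary.PropositionalEquality
  open NatVectors using (total)

  IsMaxTotal : ∀ {n} → Vec ℕ n → Subset n → ℕ → ℕ → Set
  IsMaxTotal as S c v =
    (∃[ B ] B ⊆ S × total as B ≤ c × total as B ≡ v) × (∀ B → B ⊆ S → total as B ≤ c → total as B ≤ v)

  maxTotal-∷-unusable : ∀ {n} {as : Vec ℕ n} {S c v} a s →
    (∀ B → inside ∷ B ⊆ s ∷ S → a + total as B ≤ c → ⊥) →
    IsMaxTotal as S c v → IsMaxTotal (a ∷ as) (s ∷ S) c v
  maxTotal-∷-unusable {as = as} {S} {c} {v} a s unusable ((B , B⊆S , B≤c , B≡v) , maximal) =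
    (outside ∷ B , out⊆ B⊆S , B≤c , B≡v) , maximal′
    where
    maximal′ : ∀ B → B ⊆ s ∷ S → total (a ∷ as) B ≤ c → total (a ∷ as) B ≤ v
    maximal′ (outside ∷ B) B⊆ h = maximal B (drop-∷-⊆ B⊆) h
    maximal′ (inside ∷ B)  B⊆ h = ⊥-elim (unusable B B⊆ h)

  maxTotal-∷-usable : ∀ {n} {as : Vec ℕ n} {S c v₁ v₂} a → a ≤ c →
    IsMaxTotal as S c v₁ → IsMaxTotal as S (c ∸ a) v₂ → IsMaxTotal (a ∷ as) (inside ∷ S) c (v₁ ⊔ (a + v₂))
  maxTotal-∷-usable {as = as} {S} {c} {v₁} {v₂} a a≤c
    ((B₁ , B₁⊆S , B₁≤c , B₁≡v₁) , maximal₁) ((B₂ , B₂⊆S , B₂≤c∸a , B₂≡v₂) , maximal₂) =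
    attained (⊔-sel v₁ (a + v₂)) , maximal
    where
    v = v₁ ⊔ (a + v₂)
    attained : v ≡ v₁ ⊎ v ≡ a + v₂ → ∃[ B ] B ⊆ inside ∷ S × total (a ∷ as) B ≤ c × total (a ∷ as) B ≡ v
    attained (inj₁ v≡v₁) = outside ∷ B₁ , out⊆ B₁⊆S , B₁≤c , trans B₁≡v₁ (sym v≡v₁)
    attained (inj₂ v≡a+v₂) = inside ∷ B₂ , in⊆in B₂⊆S ,
      subst (_≤ c) (+-comm (total as B₂) a) (m≤o∸n⇒m+n≤o (total as B₂) a≤c B₂≤c∸a) ,
      trans (cong (a +_) B₂≡v₂) (sym v≡a+v₂)
    maximal : ∀ B → B ⊆ inside ∷ S → total (a ∷ as) B ≤ c → total (a ∷ as) B ≤ v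
    maximal (outside ∷ B) B⊆ h = ≤-trans (maximal₁ B (drop-∷-⊆ B⊆) h) (m≤m⊔n v₁ (a + v₂))
    maximal (inside ∷ B)  B⊆ h = ≤-trans (+-monoʳ-≤ a (maximal₂ B (drop-∷-⊆ B⊆) B≤c∸a)) (m≤n⊔m v₁ (a + v₂))
      where
      B≤c∸a : total as B ≤ c ∸ a
      B≤c∸a = m+n≤o⇒m≤o∸n (total as B) (subst (_≤ c) (+-comm a (total as B)) h)

  maxTotal : ∀ {n} (as : Vec ℕ n) S c → ∃[ v ] IsMaxTotal as S c v
  maxTotal []       []            c = 0 , ([] , (λ ()) , z≤n , refl) , λ { [] _ _ → z≤n }
  maxTotal (a ∷ as) (outside ∷ S) c with maxTotal as S c
  ... | v , max = v , maxTotal-∷-unusable a outside (λ B B⊆ _ → case B⊆ here of λ ()) max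
  maxTotal (a ∷ as) (inside ∷ S)  c with a ≤? c | maxTotal as S c
  ... | no  a≰c | v , max = v , maxTotal-∷-unusable a inside (λ _ _ h → a≰c (≤-trans (m≤m+n a _) h)) max
  ... | yes a≤c | v₁ , max₁ with maxTotal as S (c ∸ a)
  ...   | v₂ , max₂ = v₁ ⊔ (a + v₂) , maxTotal-∷-usable a a≤c max₁ max₂

module FractionalInstances where

  open import Defs
  open import Data.Nat as ℕ using (suc)
  import Data.Nat.Properties as ℕ
  open import Data.Nat.Tactic.RingSolver using (solve-∀)
  open import Data.Product using (∃-syntax; _×_; _,_)
  open import Data.Vec using (Vec; []; _∷_; map)
  open import Data.Vec.Relation.Unary.All using (All; []; _∷_)
  open import Data.Fin.Subset using (inside; outside; _⊆_)
  open import Data.Rational using (ℚ; 0ℚ; 1ℚ; _+_; _≤_; _<_)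
  open import Data.Rational.Properties using (≤-refl; <⇒≤; +-mono-≤; +-identityʳ)
  open import Relation.Binary.PropositionalEquality
  open Fractions
  open NatVectors using (total)
  open Knapsack using (IsMaxTotal; maxTotal)

  fracs : ∀ {n} → ℕ → Vec ℕ n → Vec ℚ n
  fracs d = map (λ a → frac a d)

  frac-+-common : ∀ a b d → frac a d + frac b d ≡ frac (a ℕ.+ b) d
  frac-+-common a b d =
    trans (frac-+ a d b d)
          (frac-cong (a ℕ.* suc d ℕ.+ b ℕ.* suc d) (d ℕ.+ d ℕ.* suc d) (a ℕ.+ b) d (regroup a b d))
    where
    regroup : ∀ a b d → (a ℕ.* suc d ℕ.+ b ℕ.* suc d) ℕ.* suc d ≡ (a ℕ.+ b) ℕ.* suc (d ℕ.+ d ℕ.* suc d)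
    regroup = solve-∀

  sizeOf-fracs : ∀ d {n} (as : Vec ℕ n) S → sizeOf (fracs d as) S ≡ frac (total as S) d
  sizeOf-fracs d []       []            = frac-cong 0 0 0 d refl
  sizeOf-fracs d (a ∷ as) (inside ∷ S)  =
    trans (cong (frac a d +_) (sizeOf-fracs d as S)) (frac-+-common a (total as S) d)
  sizeOf-fracs d (a ∷ as) (outside ∷ S) = sizeOf-fracs d as S

  fracs-valid : ∀ {n d} {as : Vec ℕ n} → All (λ a → 1 ℕ.≤ a × a ℕ.≤ suc d) as → ValidInstance (fracs d as)
  fracs-valid []                                        = []
  fracs-valid {d = d} {a ∷ _} ((1≤a , a≤1+d) ∷ bounds) = (0<frac , ≤⇒frac≤1 a≤1+d) ∷ fracs-valid bounds
    where
    0<frac : 0ℚ < frac a d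
    0<frac = frac<frac 0 0 a d (subst (1 ℕ.≤_) (sym (ℕ.*-identityʳ a)) 1≤a)

  isBestPacking-fracs : ∀ d {n} (as : Vec ℕ n) {S v} → IsMaxTotal as S (suc d) v →
    IsBestPacking (fracs d as) S (frac v d)
  isBestPacking-fracs d as {S} {v} ((B , B⊆S , B-fits , B≡v) , maximal) =
    (B , B⊆S , fits B-fits , trans (sizeOf-fracs d as B) (cong (λ a → frac a d) B≡v)) , maximal′
    where
    fits : ∀ {B} → total as B ℕ.≤ suc d → sizeOf (fracs d as) B ≤ 1ℚ
    fits {B} h = subst (_≤ 1ℚ) (sym (sizeOf-fracs d as B)) (≤⇒frac≤1 h)
    maximal′ : ∀ B → B ⊆ S → sizeOf (fracs d as) B ≤ 1ℚ → sizeOf (fracs d as) B ≤ frac v d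
    maximal′ B B⊆S h = subst (_≤ frac v d) (sym (sizeOf-fracs d as B))
      (frac≤frac (total as B) d v d (ℕ.*-monoˡ-≤ (suc d) (maximal B B⊆S B≤c)))
      where
      B≤c : total as B ℕ.≤ suc d
      B≤c = frac≤1⇒≤ (subst (_≤ 1ℚ) (sizeOf-fracs d as B) h)

  bestPacking : ∀ d {n} (as : Vec ℕ n) S → ∃[ v ] IsBestPacking (fracs d as) S v
  bestPacking d as S with maxTotal as S (suc d)
  ... | v , max = frac v d , isBestPacking-fracs d as max

  sizeOf-nonNeg : ∀ {n} {xs : Vec ℚ n} → ValidInstance xs → ∀ S → 0ℚ ≤ sizeOf xs S
  sizeOf-nonNeg []                          []            = ≤-refl
  sizeOf-nonNeg {xs = x ∷ xs} ((0<x , _) ∷ valid) (inside ∷ S) =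
    subst (_≤ x + sizeOf xs S) (+-identityʳ 0ℚ) (+-mono-≤ (<⇒≤ 0<x) (sizeOf-nonNeg valid S))
  sizeOf-nonNeg (_ ∷ valid)                 (outside ∷ S) = sizeOf-nonNeg valid S

module Competitiveness where

  open import Defs
  open import Data.Product using (∃-syntax; Σ; _×_; _,_)
  open import Data.Vec using (Vec)
  open import Data.Fin.Subset using (⊤)
  open import Data.Rational using (ℚ; 0ℚ; _*_; _-_; _≤_; _<_; nonNegative)
  open import Data.Rational.Properties using (≤-trans; ≤-<-trans; <⇒≤; *-monoʳ-≤-nonNeg)
  open import Relation.Binary.PropositionalEquality using (subst)
  open Fractions using (p-q≤p)
  open FractionalInstances using (sizeOf-nonNeg)

  NotCompetitive : ∀ {R} → OnlineAlg R → ℚ → Set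
  NotCompetitive A c =
    ∃[ n ] Σ (Vec ℚ n) λ xs → ValidInstance xs ×
      (∃[ opt ] ∃[ alg ] IsBestPacking xs ⊤ opt × IsBestPacking xs (buffer A xs) alg × c * alg < opt)

  notCompetitive⇒compRatioAtLeast : ∀ {R} {A : OnlineAlg R} {c c′} →
    NotCompetitive A c → c′ ≤ c → CompRatioAtLeast A c′
  notCompetitive⇒compRatioAtLeast {c = c} {c′}
    (n , xs , valid , opt , alg , opt-best , alg-best@((B , _ , _ , B≡alg) , _) , c*alg<opt) c′≤c δ 0<δ =
    n , xs , valid , opt , alg , opt-best , alg-best ,
    ≤-<-trans (*-monoʳ-≤-nonNeg alg {{nonNegative 0≤alg}} c′-δ≤c) c*alg<opt
    where
    0≤alg : 0ℚ ≤ alg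
    0≤alg = subst (0ℚ ≤_) B≡alg (sizeOf-nonNeg valid B)
    c′-δ≤c : c′ - δ ≤ c
    c′-δ≤c = ≤-trans (p-q≤p c′ (<⇒≤ 0<δ)) c′≤c

module Adversary (k : ℕ) where

  open import Defs
  open import Data.Nat
  open import Data.Nat.Properties
  open import Data.Nat.Tactic.RingSolver using (solve-∀)
  open import Data.Product using (_×_; _,_; proj₁; proj₂)
  open import Data.Vec using (Vec; _∷ʳ_; map; lookup; initLast)
  open import Data.Vec.Properties using (map-∷ʳ)
  open import Data.Vec.Relation.Unary.All as All using (All)
  open import Data.Vec.Relation.Unary.All.Properties using (map⁺)
  open import Data.Fin using (Fin; toℕ)
  open import Data.Fin.Properties using (toℕ<n)
  open import Data.Fin.Subset using (inside; outside; _∉_; _⊆_; ⁅_⁆; ⊤; ∣_∣)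
  open import Data.Fin.Subset.Properties using (⊆⊤; ⊆-trans; ∣p∣≤n; ∣⊤∣≡n; ∣⁅x⁆∣≡1)
  open import Data.Rational as ℚ using (ℚ; 1ℚ)
  import Data.Rational.Properties as ℚ
  open import Relation.Binary.PropositionalEquality
  open Fractions
  open NatVectors
  open FractionalInstances
  open Competitiveness using (NotCompetitive)

  ratioBound : ℚ
  ratioBound = 1ℚ ℚ.+ frac 1 k

  M′ : ℕ
  M′ = k * (2 + k)

  M : ℕ
  M = suc M′

  -- suc d reduces to suc k * M, so frac a d is a / ((k+1)M).
  d : ℕ
  d = M′ + k * M

  prefix : Vec ℕ k
  prefix = map (λ i → i * M + 1) (countdown k)

  answer : Fin k → ℕ
  answer j = toℕ j * M + M′

  numerators : Fin k → Vec ℕ (suc k)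
  numerators j = prefix ∷ʳ answer j

  prefixInstance : Vec ℚ k
  prefixInstance = fracs d prefix

  fullInstance : Fin k → Vec ℚ (suc k)
  fullInstance j = fracs d (numerators j)

  1≤M′ : 1 ≤ k → 1 ≤ M′
  1≤M′ 1≤k = *-mono-≤ 1≤k (s≤s z≤n)

  quotient-≤ : ∀ n {a b c e} → a * n + b ≤ c * n + e → e < n → a ≤ c
  quotient-≤ n {a} {b} {c} {e} h e<n = ≤-pred (*-cancelʳ-< n a (suc c) (begin-strict
    a * n      ≤⟨ m≤m+n (a * n) b ⟩
    a * n + b  ≤⟨ h ⟩
    c * n + e  <⟨ +-monoʳ-< (c * n) e<n ⟩
    c * n + n  ≡⟨ +-comm (c * n) n ⟩
    suc c * n  ∎))
    where open ≤-Reasoning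

  bound-without-answer : ∀ {m r} → (r ≡ 0 → m ≡ 0) → r ≤ k → m * M + r ≤ suc k * M → m * M + r ≤ k * M + k
  bound-without-answer {m} {zero}  r≡0⇒m≡0 _   _ rewrite r≡0⇒m≡0 refl = z≤n
  bound-without-answer {m} {suc r} _       r≤k h = +-mono-≤ (*-monoˡ-≤ M m≤k) r≤k
    where
    m≤k : m ≤ k
    m≤k = ≤-pred (*-cancelʳ-< M m (suc k) (<-≤-trans (m<m+n (m * M) z<s) h))

  bound-with-answer : ∀ {m r t J} → 1 ≤ M′ → t + J ≡ k → (r ≤ 1 → m ≢ J) → r ≤ k →
    m * M + r + (t * M + M′) ≤ suc k * M → m * M + r + (t * M + M′) ≤ k * M + k
  bound-with-answer {m} {r} {t} {J} 1≤M′ t+J≡k r≤1⇒m≢J r≤k h = begin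
    m * M + r + (t * M + M′)        ≤⟨ +-monoˡ-≤ (t * M + M′) (+-monoʳ-≤ (m * M) r≤k) ⟩
    m * M + k + (t * M + M′)        <⟨ n<1+n _ ⟩
    suc (m * M + k + (t * M + M′))  ≡⟨ regroup m k t M′ ⟩
    suc (t + m) * M + k             ≤⟨ +-monoˡ-≤ k (*-monoˡ-≤ M (+-monoʳ-< t m<J)) ⟩
    (t + J) * M + k                 ≡⟨ cong (λ n → n * M + k) t+J≡k ⟩
    k * M + k                       ∎
    where
    open ≤-Reasoning
    regroup : ∀ m x t M′ → suc (m * suc M′ + x + (t * suc M′ + M′)) ≡ suc (t + m) * suc M′ + x
    regroup = solve-∀
    h′ : suc (t + m) * M + r ≤ suc (t + J) * M + 1
    h′ = subst₂ _≤_ (regroup m r t M′) (trans (cong (λ n → suc (suc n * M)) (sym t+J≡k)) (+-comm 1 _)) (s≤s h)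
    m≤J : m ≤ J
    m≤J = +-cancelˡ-≤ t m J (≤-pred (quotient-≤ M h′ (s≤s 1≤M′)))
    m≢J : m ≢ J
    m≢J refl = r≤1⇒m≢J (+-cancelˡ-≤ (suc (t + m) * M) r 1 h′) refl
    m<J : m < J
    m<J = ≤∧≢⇒< m≤J m≢J

  total-prefix : ∀ S → total prefix S ≡ total (countdown k) S * M + ∣ S ∣
  total-prefix = total-affine M (countdown k)

  opt-total : ∀ j → total (numerators j) (⁅ j ⁆ ∷ʳ inside) ≡ suc d
  opt-total j = begin
    total (numerators j) (⁅ j ⁆ ∷ʳ inside)                ≡⟨ total-∷ʳ-inside prefix (answer j) ⁅ j ⁆ ⟩
    total prefix ⁅ j ⁆ + answer j                         ≡⟨ cong (_+ answer j) (total-prefix ⁅ j ⁆) ⟩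
    total (countdown k) ⁅ j ⁆ * M + ∣ ⁅ j ⁆ ∣ + answer j
      ≡⟨ cong₂ (λ a b → a * M + b + answer j) (total-⁅⁆ (countdown k) j) (∣⁅x⁆∣≡1 j) ⟩
    L * M + 1 + (toℕ j * M + M′)                          ≡⟨ regroup L (toℕ j) M M′ ⟩
    suc (M′ + (toℕ j + L) * M)
      ≡⟨ cong (λ n → suc (M′ + n * M)) (toℕ+lookup-countdown j) ⟩
    suc d                                                 ∎
    where
    open ≡-Reasoning
    L = lookup (countdown k) j
    regroup : ∀ L t M M′ → L * M + 1 + (t * M + M′) ≡ suc (M′ + (t + L) * M)
    regroup = solve-∀

  alg-total : ∀ j {S B} → j ∉ S → B ⊆ S ∷ʳ inside →
    total (numerators j) B ≤ suc d → total (numerators j) B ≤ k * M + k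
  alg-total j {S} {B} j∉S B⊆ with initLast B
  ... | B′ , outside , refl rewrite total-∷ʳ-outside prefix (answer j) B′ | total-prefix B′ =
    bound-without-answer (∣p∣≡0⇒total≡0 (countdown k) B′) (∣p∣≤n B′)
  ... | B′ , inside , refl rewrite total-∷ʳ-inside prefix (answer j) B′ | total-prefix B′ =
    bound-with-answer (1≤M′ (≤-trans (s≤s z≤n) (toℕ<n j))) (toℕ+lookup-countdown j) m≢J (∣p∣≤n B′)
    where
    m≢J : ∣ B′ ∣ ≤ 1 → total (countdown k) B′ ≢ lookup (countdown k) j
    m≢J ∣B′∣≤1 = total≢lookup (countdown k) lookup-countdown-injective B′ j
      (lookup-countdown-positive j) ∣B′∣≤1 (λ j∈B′ → j∉S (∷ʳ-⊆⁻ B⊆ j∈B′))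

  ratioBound*frac<1 : ∀ {v} → v ≤ k * M + k → ratioBound ℚ.* frac v d ℚ.< 1ℚ
  ratioBound*frac<1 {v} v≤ =
    subst (ℚ._< 1ℚ) (sym (trans (cong (ℚ._* frac v d) (frac-+ 1 0 1 k)) (frac-* a d′ v d)))
    (frac<frac (a * v) (d + d′ * suc d) 1 0 (begin-strict
      a * v * 1                              ≡⟨ simplifyˡ k v ⟩
      (2 + k) * v                            ≤⟨ *-monoʳ-≤ (2 + k) v≤ ⟩
      (2 + k) * (k * M + k)                  <⟨ n<1+n _ ⟩
      suc ((2 + k) * (k * M + k))            ≡⟨ key k ⟩
      suc k * (suc k * M)                    ≡⟨ simplifyʳ k M′ ⟩
      1 * suc (d + d′ * suc d)               ∎))
    where
    open ≤-Reasoning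
    a = 1 * suc k + 1 * 1
    d′ = k + 0 * suc k
    simplifyˡ : ∀ k v → (1 * suc k + 1 * 1) * v * 1 ≡ (2 + k) * v
    simplifyˡ = solve-∀
    key : ∀ k → suc ((2 + k) * (k * suc (k * (2 + k)) + k)) ≡ suc k * (suc k * suc (k * (2 + k)))
    key = solve-∀
    simplifyʳ : ∀ k M′ → suc k * (suc k * suc M′) ≡
      1 * suc ((M′ + k * suc M′) + (k + 0 * suc k) * suc (M′ + k * suc M′))
    simplifyʳ = solve-∀

  k<2*sizeOf-prefix : 1 ≤ k → frac k 0 ℚ.< frac 2 0 ℚ.* sizeOf prefixInstance ⊤
  k<2*sizeOf-prefix 1≤k =
    subst (frac k 0 ℚ.<_) (sym size) (frac<frac k 0 (2 * T) (d + 0 * suc d) (begin-strict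
    k * suc (d + 0 * suc d)      ≡⟨ cong (λ n → k * suc n) (+-identityʳ d) ⟩
    k * (suc k * M)              ≡⟨ *-assoc k (suc k) M ⟨
    k * suc k * M                ≡⟨ cong (_* M) (total-countdown-⊤ k) ⟨
    C * 2 * M                    <⟨ m<m+n (C * 2 * M) (≤-trans (s≤s z≤n) (*-monoʳ-≤ 2 1≤k)) ⟩
    C * 2 * M + 2 * k            ≡⟨ regroup C M k ⟩
    2 * (C * M + k) * 1          ≡⟨ cong (λ n → 2 * (C * M + n) * 1) (∣⊤∣≡n k) ⟨
    2 * (C * M + ∣ ⊤ {k} ∣) * 1  ≡⟨ cong (λ n → 2 * n * 1) (total-prefix ⊤) ⟨
    2 * T * 1                    ∎))
    where
    open ≤-Reasoning
    C = total (countdown k) ⊤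
    T = total prefix ⊤
    size : frac 2 0 ℚ.* sizeOf prefixInstance ⊤ ≡ frac (2 * T) (d + 0 * suc d)
    size = trans (cong (frac 2 0 ℚ.*_) (sizeOf-fracs d prefix ⊤)) (frac-* 2 0 T d)
    regroup : ∀ C M k → C * 2 * M + 2 * k ≡ 2 * (C * M + k) * 1
    regroup = solve-∀

  prefix-bounds : All (λ a → 1 ≤ a × a ≤ suc d) prefix
  prefix-bounds = map⁺ (All.map bounds (countdown-≤ k))
    where
    bounds : ∀ {i} → i ≤ k → 1 ≤ i * M + 1 × i * M + 1 ≤ suc d
    bounds {i} i≤k = m≤n+m 1 (i * M) ,
      subst (_≤ suc d) (+-comm 1 (i * M)) (s≤s (≤-trans (*-monoˡ-≤ M i≤k) (m≤n+m (k * M) M′)))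

  numerators-bounds : ∀ j → All (λ a → 1 ≤ a × a ≤ suc d) (numerators j)
  numerators-bounds j = All-∷ʳ⁺ prefix-bounds
    ( ≤-trans (1≤M′ (≤-trans (s≤s z≤n) (toℕ<n j))) (m≤n+m M′ (toℕ j * M))
    , ≤-trans (subst (_≤ d) (+-comm M′ (toℕ j * M)) (+-monoʳ-≤ M′ (*-monoˡ-≤ M (<⇒≤ (toℕ<n j))))) (n≤1+n d))

  prefix-valid : ValidInstance prefixInstance
  prefix-valid = fracs-valid prefix-bounds

  full-valid : ∀ j → ValidInstance (fullInstance j)
  full-valid j = fracs-valid (numerators-bounds j)

  opt-best : ∀ j → IsBestPacking (fullInstance j) ⊤ 1ℚ
  opt-best j = (⁅ j ⁆ ∷ʳ inside , ⊆⊤ , ℚ.≤-reflexive size≡1 , size≡1) , λ _ _ B≤1 → B≤1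
    where
    size≡1 : sizeOf (fullInstance j) (⁅ j ⁆ ∷ʳ inside) ≡ 1ℚ
    size≡1 = trans (sizeOf-fracs d (numerators j) (⁅ j ⁆ ∷ʳ inside))
                   (trans (cong (λ a → frac a d) (opt-total j)) (frac-1 d))

  buffer-removable : ∀ {R} (A : OnlineAlg R) j → buffer A (fullInstance j) ⊆ buffer A prefixInstance ∷ʳ inside
  buffer-removable A j = subst (λ ys → buffer A ys ⊆ buffer A prefixInstance ∷ʳ inside) (sym full≡)
    (removable A prefixInstance (frac (answer j) d) (subst ValidInstance full≡ (full-valid j)))
    where
    full≡ : fullInstance j ≡ prefixInstance ∷ʳ frac (answer j) d
    full≡ = map-∷ʳ (λ a → frac a d) (answer j) prefix

  ratioBound*alg<1 : ∀ j {S T alg} → j ∉ S → T ⊆ S ∷ʳ inside → IsBestPacking (fullInstance j) T alg →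
    ratioBound ℚ.* alg ℚ.< 1ℚ
  ratioBound*alg<1 j j∉S T⊆ ((B , B⊆T , B≤1 , refl) , _) rewrite sizeOf-fracs d (numerators j) B =
    ratioBound*frac<1 (alg-total j j∉S (⊆-trans B⊆T T⊆) (frac≤1⇒≤ B≤1))

  missing⇒notCompetitive : ∀ {R} (A : OnlineAlg R) j → j ∉ buffer A prefixInstance →
    NotCompetitive A ratioBound
  missing⇒notCompetitive A j j∉S =
    suc k , fullInstance j , full-valid j , 1ℚ , alg , opt-best j , alg-best ,
    ratioBound*alg<1 j j∉S (buffer-removable A j) alg-best
    where
    packing = bestPacking d (numerators j) (buffer A (fullInstance j))
    alg = proj₁ packing
    alg-best = proj₂ packing

  R<prefix⇒notCompetitive : ∀ {R} (A : OnlineAlg R) → R ℚ.< sizeOf prefixInstance ⊤ →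
    NotCompetitive A ratioBound
  R<prefix⇒notCompetitive {R} A R<prefix = missing⇒notCompetitive A j j∉S
    where
    S≢⊤ : buffer A prefixInstance ≢ ⊤
    S≢⊤ S≡⊤ = ℚ.<-irrefl refl (ℚ.≤-<-trans
      (subst (λ S → sizeOf prefixInstance S ℚ.≤ R) S≡⊤ (capacity A prefixInstance prefix-valid)) R<prefix)
    j = proj₁ (≢⊤⇒∃∉ S≢⊤)
    j∉S = proj₂ (≢⊤⇒∃∉ S≢⊤)

open import Defs
open import Data.Rational using (ℚ; 0ℚ; 1ℚ; _-_; _≤_; _<_)
import Data.Nat.Base as ℕ
import Data.Nat.Properties as ℕ
import Data.Integer as ℤ
open import Data.Fin.Subset using (⊤)
open import Data.Rational using (_*_; ceiling)
open import Data.Rational.Properties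
  using (≤-trans; ≤-<-trans; <⇒≤; *-identityʳ; *-monoˡ-≤-nonNeg; *-cancelˡ-<-nonNeg)
open import Relation.Binary.PropositionalEquality using (subst)
open Fractions using (frac; frac≤frac⇒*≤*; p≤frac∣⌈p⌉∣; p-q≤p)
open Competitiveness using (NotCompetitive; notCompetitive⇒compRatioAtLeast)

notCompetitive : ∀ {R} (A : OnlineAlg R) → 1ℚ ≤ R → NotCompetitive A (bound R)
notCompetitive {R} A 1≤R = Adversary.R<prefix⇒notCompetitive k A R<prefix
  where
  k = ℤ.∣ ceiling (frac 2 0 * R) ∣
  2R≤k : frac 2 0 * R ≤ frac k 0
  2R≤k = p≤frac∣⌈p⌉∣ (frac 2 0 * R)
  2≤2R : frac 2 0 ≤ frac 2 0 * R
  2≤2R = subst (_≤ frac 2 0 * R) (*-identityʳ (frac 2 0)) (*-monoˡ-≤-nonNeg (frac 2 0) 1≤R)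
  1<k : 1 ℕ.< k
  1<k = subst (2 ℕ.≤_) (ℕ.*-identityʳ k) (frac≤frac⇒*≤* 2 0 k 0 (≤-trans 2≤2R 2R≤k))
  R<prefix : R < sizeOf (Adversary.prefixInstance k) ⊤
  R<prefix = *-cancelˡ-<-nonNeg (frac 2 0) (≤-<-trans 2R≤k (Adversary.k<2*sizeOf-prefix k (ℕ.<⇒≤ 1<k)))

theorem17 : (R ε : ℚ) → 1ℚ ≤ R → 0ℚ < ε → ε < 1ℚ →
    (A : OnlineAlg R) → CompRatioAtLeast A (bound R - ε)
theorem17 R ε 1≤R 0<ε _ A =
  notCompetitive⇒compRatioAtLeast {A = A} {bound R} (notCompetitive A 1≤R) (p-q≤p (bound R) (<⇒≤ 0<ε))
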